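{- Let $n\ge 11$ and $T_{n,n-2}=\frac{n(n+1)}{2}-(n-2)$. Then $\#\mathbb U^*_{T_{n,n-2}}=1$.
   Context: A partition of $N$ into distinct parts is a sequence of positive integers $\lambda_1<\dots<\lambda_t$ summing to $N$ with $t\ge 2$. Its missing parts are the elements of $\{1,\dots,\lambda_t\}\setminus\{\lambda_1,\dots,\lambda_t\}$. $\lambda$ is refinable if two distinct missing parts sum to a part of $\lambda$, unrefinable otherwise; $\mathbb U_N$ is the set of unrefinable partitions of $N$. $\mathbb U^*_N$ is the set of $\lambda\in\mathbb U_N$ whose largest part is the maximum of the largest parts over all of $\mathbb U_N$. Standing assumption: $n\ge 11$. -}

module Defs where

open import Data.Nat using (ℕ; _+_; _*_; _∸_; _≤_; _<_; _⊔_; suc)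
open import Data.Nat.DivMod using (_/_)
open import Data.List using (List; length; foldr)
open import Data.Nat.ListAction using (sum)
open import Data.List.Membership.Propositional using (_∈_; _∉_)
open import Data.List.Relation.Unary.All using (All)
open import Data.List.Relation.Unary.Linked using (Linked)
open import Data.Product using (_×_; ∃-syntax)
open import Relation.Binary.PropositionalEquality using (_≡_)
open import Relation.Nullary using (¬_)

largest : List ℕ → ℕ
largest = foldr _⊔_ 0

IsDistinctPartition : ℕ → List ℕ → Set
IsDistinctPartition N λs =
  Linked _<_ λs × All (λ x → 1 ≤ x) λs × sum λs ≡ N × 2 ≤ length λs

IsMissing : List ℕ → ℕ → Set
IsMissing λs m = 1 ≤ m × m ≤ largest λs × m ∉ λs

Refinable : List ℕ → Set
Refinable λs = ∃[ a ] ∃[ b ]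
  (IsMissing λs a × IsMissing λs b × ¬ (a ≡ b) × (a + b) ∈ λs)

Unrefinable : ℕ → List ℕ → Set
Unrefinable N λs = IsDistinctPartition N λs × ¬ Refinable λs

MaxUnrefinable : ℕ → List ℕ → Set
MaxUnrefinable N λs =
  Unrefinable N λs × (∀ μ → Unrefinable N μ → largest μ ≤ largest λs)

T : ℕ → ℕ → ℕ
T n k = (n * suc n) / 2 ∸ k

-- Let μ be unrefinable with largest part m = 2k + 1 + r, r ≤ 1. For 1 ≤ a ≤ k one of a, m − a
-- is a part, for otherwise they are two distinct missing parts summing to m. Grouping the parts
-- below m into the pairs {a, m − a} gives sum μ = m + (1 + ⋯ + k) + E with E ≥ 0 the total
-- excess of the pairs over a (plus the middle part k + 1 when r = 1).
-- For n = 11 + p we have N = T(n, n − 2) = (1 + ⋯ + (9 + p)) + 12 + p, so k ≤ 8 + p. For k = 8 + p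
-- and r = 1 the excesses would add up to 3, but each of them is even or at least 4. For r = 0,
-- i.e. m = 17 + 2p, they add up to 4: every pair with a ≤ 6 + p has excess 0 or at least 5,
-- hence keeps a alone, and the two remaining pairs must both keep their upper element.
-- This determines μ, and that partition is indeed unrefinable.
{-# OPTIONS --safe #-}
module Submission where

open import Defs
open import Data.Nat
open import Data.Nat.Properties
open import Data.Nat.Tactic.RingSolver using (solve-∀)
open import Data.Nat.DivMod using (_/_; m*n/n≡m)
open import Data.Nat.Divisibility using (_∣_; _∣?_; divides; ∣m∣n⇒∣m+n; ∣m+n∣m⇒∣n)
open import Data.Nat.ListAction using (sum)
open import Data.Nat.ListAction.Properties using (sum-++)
open import Data.List using (List; []; _∷_; _++_; length)
open import Data.List.Properties using (length-++)
open import Data.List.Membership.Propositional using (_∈_; _∉_)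
open import Data.List.Membership.Propositional.Properties using (∈-++⁺ˡ; ∈-++⁺ʳ; ∈-++⁻)
open import Data.List.Membership.DecPropositional _≟_ using (_∈?_)
open import Data.List.Relation.Unary.Any using (here; there)
open import Data.List.Relation.Unary.All as All using (All; []; _∷_)
open import Data.List.Relation.Unary.Linked as Linked using (Linked; []; [-]; _∷_)
open import Data.List.Relation.Unary.Linked.Properties using (Linked⇒All)
open import Data.Product using (_×_; _,_; proj₁; proj₂; ∃-syntax)
open import Data.Sum using (_⊎_; inj₁; inj₂; [_,_]′)
open import Data.Empty using (⊥)
open import Relation.Nullary using (¬_; Dec; yes; no; contradiction)
open import Function using (_∘_)
open import Relation.Nullary.Decidable using (from-no)
open import Relation.Binary.PropositionalEquality
open import Relation.Binary.Definitions using (tri<; tri≈; tri>)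

≰-by : ∀ {a b} d → b + suc d ≡ a → ¬ a ≤ b
≰-by {b = b} d b+1+d≡a a≤b = m+1+n≰m b (subst (_≤ b) (sym b+1+d≡a) a≤b)

rangeSum : (ℕ → ℕ) → ℕ → ℕ → ℕ
rangeSum f lo zero    = 0
rangeSum f lo (suc l) = f lo + rangeSum f (suc lo) l

rangeSum-snoc : ∀ f lo l → rangeSum f lo (suc l) ≡ rangeSum f lo l + f (lo + l)
rangeSum-snoc f lo zero    = trans (+-identityʳ (f lo)) (cong f (sym (+-identityʳ lo)))
rangeSum-snoc f lo (suc l) = begin
  f lo + rangeSum f (suc lo) (suc l)             ≡⟨ cong (f lo +_) (rangeSum-snoc f (suc lo) l) ⟩
  f lo + (rangeSum f (suc lo) l + f (suc lo + l)) ≡⟨ sym (+-assoc (f lo) _ _) ⟩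
  f lo + rangeSum f (suc lo) l + f (suc lo + l)   ≡⟨ cong (λ z → f lo + rangeSum f (suc lo) l + f z) (sym (+-suc lo l)) ⟩
  f lo + rangeSum f (suc lo) l + f (lo + suc l)   ∎
  where open ≡-Reasoning

rangeSum-+ : ∀ f g lo l → rangeSum (λ y → f y + g y) lo l ≡ rangeSum f lo l + rangeSum g lo l
rangeSum-+ f g lo zero    = refl
rangeSum-+ f g lo (suc l) =
  trans (cong (f lo + g lo +_) (rangeSum-+ f g (suc lo) l)) (+-interchange (f lo) (g lo) _ _)
  where
  +-interchange : ∀ a b c d → (a + b) + (c + d) ≡ (a + c) + (b + d)
  +-interchange = solve-∀

rangeSum-zero : ∀ lo l → rangeSum (λ _ → 0) lo l ≡ 0
rangeSum-zero lo zero    = refl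
rangeSum-zero lo (suc l) = rangeSum-zero (suc lo) l

sumTo : (ℕ → ℕ) → ℕ → ℕ
sumTo g zero    = 0
sumTo g (suc k) = sumTo g k + g (suc k)

triangle : ℕ → ℕ
triangle = sumTo (λ a → a)

triangle-mono-≤ : ∀ {a b} → a ≤ b → triangle a ≤ triangle b
triangle-mono-≤ {b = zero}  z≤n = z≤n
triangle-mono-≤ {b = suc b} a≤b with m≤n⇒m<n∨m≡n a≤b
... | inj₁ a<1+b = ≤-trans (triangle-mono-≤ (≤-pred a<1+b)) (m≤m+n _ _)
... | inj₂ refl  = ≤-refl

*-suc-triangle : ∀ n → n * suc n ≡ triangle n * 2
*-suc-triangle zero    = refl
*-suc-triangle (suc n) = begin
  suc n * suc (suc n)           ≡⟨ expand n ⟩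
  n * suc n + 2 * suc n         ≡⟨ cong (_+ 2 * suc n) (*-suc-triangle n) ⟩
  triangle n * 2 + 2 * suc n    ≡⟨ collect (triangle n) n ⟩
  (triangle n + suc n) * 2      ∎
  where
  open ≡-Reasoning
  expand : ∀ n → suc n * suc (suc n) ≡ n * suc n + 2 * suc n
  expand = solve-∀
  collect : ∀ t n → t * 2 + 2 * suc n ≡ (t + suc n) * 2
  collect = solve-∀

term≤sumTo : ∀ g {k a} → 1 ≤ a → a ≤ k → g a ≤ sumTo g k
term≤sumTo g {zero}  1≤a a≤0 = contradiction (≤-trans 1≤a a≤0) λ ()
term≤sumTo g {suc k} 1≤a a≤k with m≤n⇒m<n∨m≡n a≤k
... | inj₁ a<1+k = ≤-trans (term≤sumTo g 1≤a (≤-pred a<1+k)) (m≤m+n _ _)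
... | inj₂ refl  = m≤n+m _ _

sumTo-∸-triangle : ∀ h k → (∀ a → 1 ≤ a → a ≤ k → a ≤ h a) →
  sumTo h k ≡ triangle k + sumTo (λ a → h a ∸ a) k
sumTo-∸-triangle h zero    _  = refl
sumTo-∸-triangle h (suc k) a≤h = begin
  sumTo h k + h (suc k)
    ≡⟨ cong₂ _+_ (sumTo-∸-triangle h k (λ a 1≤a a≤k → a≤h a 1≤a (m≤n⇒m≤1+n a≤k)))
                 (sym (m+[n∸m]≡n (a≤h (suc k) (s≤s z≤n) ≤-refl))) ⟩
  triangle k + sumTo e k + (suc k + e (suc k))
    ≡⟨ interchange (triangle k) (sumTo e k) (suc k) (e (suc k)) ⟩
  triangle k + suc k + (sumTo e k + e (suc k)) ∎
  where
  open ≡-Reasoning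
  e = λ a → h a ∸ a
  interchange : ∀ a b c d → a + b + (c + d) ≡ a + c + (b + d)
  interchange = solve-∀

sumTo-closed : ∀ (P : ℕ → Set) → P 0 → (∀ {x y} → P x → P y → P (x + y)) →
  ∀ g k → (∀ a → 1 ≤ a → a ≤ k → P (g a)) → P (sumTo g k)
sumTo-closed P P0 P+ g zero    _  = P0
sumTo-closed P P0 P+ g (suc k) Pg =
  P+ (sumTo-closed P P0 P+ g k (λ a 1≤a a≤k → Pg a 1≤a (m≤n⇒m≤1+n a≤k))) (Pg (suc k) (s≤s z≤n) ≤-refl)

rangeSum-pairUp : ∀ f j r m → m ≡ suc (j + j + r) →
  rangeSum f 0 m ≡ f 0 + sumTo (λ a → f a + f (m ∸ a)) j + rangeSum f (suc j) r
rangeSum-pairUp f zero    r .(suc r) refl = cong (_+ rangeSum f 1 r) (sym (+-identityʳ (f 0)))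
rangeSum-pairUp f (suc j) r .(suc (suc j + suc j + r)) refl = begin
  rangeSum f 0 m
    ≡⟨ rangeSum-pairUp f j (suc (suc r)) m (shift j r) ⟩
  f 0 + S j + (f (suc j) + rangeSum f (suc (suc j)) (suc r))
    ≡⟨ cong (λ z → f 0 + S j + (f (suc j) + z)) (rangeSum-snoc f (suc (suc j)) r) ⟩
  f 0 + S j + (f (suc j) + (rangeSum f (suc (suc j)) r + f (suc (suc j) + r)))
    ≡⟨ cong (λ z → f 0 + S j + (f (suc j) + (rangeSum f (suc (suc j)) r + f z))) (sym partner) ⟩
  f 0 + S j + (f (suc j) + (rangeSum f (suc (suc j)) r + f (m ∸ suc j)))
    ≡⟨ regroup (f 0) (S j) (f (suc j)) (rangeSum f (suc (suc j)) r) (f (m ∸ suc j)) ⟩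
  f 0 + (S j + (f (suc j) + f (m ∸ suc j))) + rangeSum f (suc (suc j)) r ∎
  where
  open ≡-Reasoning
  m = suc (suc j + suc j + r)
  S = sumTo (λ a → f a + f (m ∸ a))
  shift : ∀ j r → suc (suc j + suc j + r) ≡ suc (j + j + suc (suc r))
  shift = solve-∀
  partner : m ∸ suc j ≡ suc (suc j) + r
  partner = trans (cong (_∸ suc j) (split j r)) (m+n∸m≡n (suc j) _)
    where
    split : ∀ j r → suc (suc j + suc j + r) ≡ suc j + suc (suc j + r)
    split = solve-∀
  regroup : ∀ a b c d e → a + b + (c + (d + e)) ≡ a + (b + (c + e)) + d
  regroup = solve-∀

δ : ℕ → ℕ → ℕ
δ x y with x ≟ y
... | yes _ = y
... | no  _ = 0

δ-refl : ∀ x → δ x x ≡ x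
δ-refl x with x ≟ x
... | yes _  = refl
... | no x≢x = contradiction refl x≢x

δ-≢ : ∀ {x y} → x ≢ y → δ x y ≡ 0
δ-≢ {x} {y} x≢y with x ≟ y
... | yes x≡y = contradiction x≡y x≢y
... | no  _   = refl

δ-zero : ∀ x → δ x 0 ≡ 0
δ-zero x with x ≟ 0
... | yes _ = refl
... | no  _ = refl

rangeSum-δ-below : ∀ x lo l → lo + l ≤ x → rangeSum (δ x) lo l ≡ 0
rangeSum-δ-below x lo zero    _   = refl
rangeSum-δ-below x lo (suc l) ≤x =
  cong₂ _+_ (δ-≢ (λ x≡lo → m+1+n≰m lo (subst (lo + suc l ≤_) x≡lo ≤x)))
            (rangeSum-δ-below x (suc lo) l (subst (_≤ x) (+-suc lo l) ≤x))

rangeSum-δ : ∀ x B → x < B → rangeSum (δ x) 0 B ≡ x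
rangeSum-δ x (suc B) x<1+B = trans (rangeSum-snoc (δ x) 0 B) (last (x ≟ B))
  where
  last : Dec (x ≡ B) → rangeSum (δ x) 0 B + δ x B ≡ x
  last (yes refl) = cong₂ _+_ (rangeSum-δ-below x 0 x ≤-refl) (δ-refl x)
  last (no x≢B)   = trans (cong₂ _+_ (rangeSum-δ x B (≤∧≢⇒< (≤-pred x<1+B) x≢B)) (δ-≢ x≢B)) (+-identityʳ x)

weight : List ℕ → ℕ → ℕ
weight []       y = 0
weight (x ∷ xs) y = δ x y + weight xs y

sum≡rangeSum-weight : ∀ xs B → All (_< B) xs → sum xs ≡ rangeSum (weight xs) 0 B
sum≡rangeSum-weight []       B _ = sym (rangeSum-zero 0 B)
sum≡rangeSum-weight (x ∷ xs) B (x<B ∷ xs<B) = sym (begin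
  rangeSum (weight (x ∷ xs)) 0 B                   ≡⟨ rangeSum-+ (δ x) (weight xs) 0 B ⟩
  rangeSum (δ x) 0 B + rangeSum (weight xs) 0 B    ≡⟨ cong₂ _+_ (rangeSum-δ x B x<B) (sym (sum≡rangeSum-weight xs B xs<B)) ⟩
  x + sum xs                                        ∎)
  where open ≡-Reasoning

weight-zero : ∀ xs → weight xs 0 ≡ 0
weight-zero []       = refl
weight-zero (x ∷ xs) = cong₂ _+_ (δ-zero x) (weight-zero xs)

weight-∉ : ∀ {y} xs → y ∉ xs → weight xs y ≡ 0
weight-∉ []       _   = refl
weight-∉ (x ∷ xs) y∉ = cong₂ _+_ (δ-≢ (λ x≡y → y∉ (here (sym x≡y)))) (weight-∉ xs (y∉ ∘ there))

head<tail : ∀ {x xs} → Linked _<_ (x ∷ xs) → All (x <_) xs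
head<tail [-]          = []
head<tail (x<y ∷ rest) = Linked⇒All <-trans x<y rest

head∉tail : ∀ {x xs} → Linked _<_ (x ∷ xs) → x ∉ xs
head∉tail sorted x∈xs = <-irrefl refl (All.lookup (head<tail sorted) x∈xs)

weight-∈ : ∀ {y} xs → Linked _<_ xs → y ∈ xs → weight xs y ≡ y
weight-∈ (x ∷ xs) sorted (here refl) =
  trans (cong₂ _+_ (δ-refl x) (weight-∉ xs (head∉tail sorted))) (+-identityʳ x)
weight-∈ (x ∷ xs) sorted (there y∈xs) =
  cong₂ _+_ (δ-≢ {x} (λ { refl → head∉tail sorted y∈xs })) (weight-∈ xs (Linked.tail sorted) y∈xs)

largest-∈ : ∀ x xs → largest (x ∷ xs) ∈ x ∷ xs
largest-∈ x []       = here (⊔-identityʳ x)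
largest-∈ x (y ∷ ys) with ⊔-sel x (largest (y ∷ ys))
... | inj₁ ≡x = here ≡x
... | inj₂ ≡l = there (subst (_∈ y ∷ ys) (sym ≡l) (largest-∈ y ys))

≤-largest : ∀ xs → All (_≤ largest xs) xs
≤-largest []       = []
≤-largest (x ∷ xs) = m≤m⊔n x _ ∷ All.map (λ y≤ → ≤-trans y≤ (m≤n⊔m x _)) (≤-largest xs)

largest-≤ : ∀ {b} xs → All (_≤ b) xs → largest xs ≤ b
largest-≤ []       _          = z≤n
largest-≤ (x ∷ xs) (x≤ ∷ xs≤) = ⊔-lub x≤ (largest-≤ xs xs≤)

largest-≡ : ∀ {b} xs → All (_≤ b) xs → b ∈ xs → largest xs ≡ b
largest-≡ xs xs≤b b∈xs = ≤-antisym (largest-≤ xs xs≤b) (All.lookup (≤-largest xs) b∈xs)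

strictlySorted-ext : ∀ xs ys → Linked _<_ xs → Linked _<_ ys →
  (∀ {z} → z ∈ xs → z ∈ ys) → (∀ {z} → z ∈ ys → z ∈ xs) → xs ≡ ys
strictlySorted-ext []       []       _ _ _ _ = refl
strictlySorted-ext []       (y ∷ ys) _ _ _ ⊇ with ⊇ (here refl)
... | ()
strictlySorted-ext (x ∷ xs) []       _ _ ⊆ _ with ⊆ (here refl)
... | ()
strictlySorted-ext (x ∷ xs) (y ∷ ys) sx sy ⊆ ⊇ with <-cmp x y
... | tri< x<y _ _ = contradiction (⊆ (here refl)) λ
  { (here refl)  → <-irrefl refl x<y
  ; (there x∈ys) → <-asym x<y (All.lookup (head<tail sy) x∈ys) }
... | tri> _ _ y<x = contradiction (⊇ (here refl)) λ
  { (here refl)  → <-irrefl refl y<x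
  ; (there y∈xs) → <-asym y<x (All.lookup (head<tail sx) y∈xs) }
... | tri≈ _ refl _ = cong (x ∷_)
  (strictlySorted-ext xs ys (Linked.tail sx) (Linked.tail sy) (drop sx sy ⊆) (drop sy sx ⊇))
  where
  drop : ∀ {us vs} → Linked _<_ (x ∷ us) → Linked _<_ (x ∷ vs) →
    (∀ {z} → z ∈ x ∷ us → z ∈ x ∷ vs) → ∀ {z} → z ∈ us → z ∈ vs
  drop su sv ⊆′ z∈us with ⊆′ (there z∈us)
  ... | here refl = contradiction z∈us (head∉tail su)
  ... | there z∈vs = z∈vs

interval : ℕ → ℕ → List ℕ
interval s zero    = []
interval s (suc l) = s ∷ interval (suc s) l

∈-interval⁻ : ∀ {x} s l → x ∈ interval s l → s ≤ x × x < s + l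
∈-interval⁻ s (suc l) (here refl) = ≤-refl , m<m+n s z<s
∈-interval⁻ {x} s (suc l) (there x∈) with ∈-interval⁻ (suc s) l x∈
... | s<x , x< = <⇒≤ s<x , subst (x <_) (sym (+-suc s l)) x<

∈-interval⁺ : ∀ {x} s l → s ≤ x → x < s + l → x ∈ interval s l
∈-interval⁺ {x} s zero    s≤x x<s+0 = contradiction (≤-trans x<s+0 (≤-trans (≤-reflexive (+-identityʳ s)) s≤x)) (<-irrefl refl)
∈-interval⁺ {x} s (suc l) s≤x x<    with m≤n⇒m<n∨m≡n s≤x
... | inj₂ refl = here refl
... | inj₁ s<x  = there (∈-interval⁺ (suc s) l s<x (subst (x <_) (+-suc s l) x<))

sum-interval : ∀ s l → sum (interval (suc s) l) ≡ l * s + triangle l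
sum-interval s zero    = refl
sum-interval s (suc l) = trans (cong (suc s +_) (sum-interval (suc s) l)) (regroup s l (triangle l))
  where
  regroup : ∀ s l t → suc s + (l * suc s + t) ≡ suc l * s + (t + suc l)
  regroup = solve-∀

interval-++-sorted : ∀ s l ys → Linked _<_ ys → All (s + l ≤_) ys → Linked _<_ (interval s l ++ ys)
interval-++-sorted s zero          ys       sy _          = sy
interval-++-sorted s (suc zero)    []       _  _          = [-]
interval-++-sorted s (suc zero)    (y ∷ ys) sy (s+1≤y ∷ _) = subst (_≤ y) (+-comm s 1) s+1≤y ∷ sy
interval-++-sorted s (suc (suc l)) ys       sy ys≥ =
  n<1+n s ∷ interval-++-sorted (suc s) (suc l) ys sy (All.map (λ {y} → subst (_≤ y) (+-suc s (suc l))) ys≥)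

halve : ∀ m → ∃[ k ] (m ≡ k + k ⊎ m ≡ suc (k + k))
halve zero    = 0 , inj₁ refl
halve (suc m) with halve m
... | k , inj₁ m≡2k   = k , inj₂ (cong suc m≡2k)
... | k , inj₂ m≡2k+1 = suc k , inj₁ (trans (cong suc m≡2k+1) (cong suc (sym (+-suc k k))))

positive-halve : ∀ m → 1 ≤ m → ∃[ k ] ∃[ r ] (r ≤ 1 × m ≡ suc (k + k + r))
positive-halve (suc m) _ with halve m
... | k , inj₁ m≡2k   = k , 0 , z≤n , cong suc (trans m≡2k (sym (+-identityʳ (k + k))))
... | k , inj₂ m≡2k+1 = k , 1 , ≤-refl , cong suc (trans m≡2k+1 (+-comm 1 (k + k)))

module LargestPart
  (μ : List ℕ) (m : ℕ) (sorted : Linked _<_ μ) (m∈μ : m ∈ μ) (μ≤m : All (_≤ m) μ)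
  (unrefinable : ¬ Refinable μ) where

  complement-∈ : ∀ a → 1 ≤ a → a + a < m → a ∈ μ ⊎ m ∸ a ∈ μ
  complement-∈ a 1≤a 2a<m with a ∈? μ | m ∸ a ∈? μ
  ... | yes a∈ | _      = inj₁ a∈
  ... | no _   | yes b∈ = inj₂ b∈
  ... | no a∉  | no b∉  = contradiction
    ((a , m ∸ a , (1≤a , a≤largest , a∉) , (m<n⇒0<n∸m a<m , b≤largest , b∉) , a≢b , a+b∈)) unrefinable
    where
    a<m = ≤-<-trans (m≤m+n a a) 2a<m
    largest≡m = largest-≡ μ μ≤m m∈μ
    a≤largest = subst (a ≤_) (sym largest≡m) (<⇒≤ a<m)
    b≤largest = subst (m ∸ a ≤_) (sym largest≡m) (m∸n≤m m a)
    a+b≡m = m+[n∸m]≡n (<⇒≤ a<m)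
    a≢b : a ≢ m ∸ a
    a≢b a≡b = <-irrefl (trans (cong (a +_) a≡b) a+b≡m) 2a<m
    a+b∈ = subst (_∈ μ) (sym a+b≡m) m∈μ

  excess : ℕ → ℕ
  excess a = weight μ a + weight μ (m ∸ a) ∸ a

  data Pair (a : ℕ) : Set where
    lower : a ∈ μ → m ∸ a ∉ μ → excess a ≡ 0         → Pair a
    upper : a ∉ μ → m ∸ a ∈ μ → excess a ≡ m ∸ a ∸ a → Pair a
    both  : a ∈ μ → m ∸ a ∈ μ → excess a ≡ m ∸ a     → Pair a

  pair : ∀ a → 1 ≤ a → a + a < m → Pair a
  pair a 1≤a 2a<m with a ∈? μ | m ∸ a ∈? μ
  ... | yes a∈ | no b∉  = lower a∈ b∉
    (trans (cong₂ (λ u v → u + v ∸ a) (weight-∈ μ sorted a∈) (weight-∉ μ b∉)) (m+n∸m≡n a 0))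
  ... | no a∉  | yes b∈ = upper a∉ b∈
    (cong₂ (λ u v → u + v ∸ a) (weight-∉ μ a∉) (weight-∈ μ sorted b∈))
  ... | yes a∈ | yes b∈ = both a∈ b∈
    (trans (cong₂ (λ u v → u + v ∸ a) (weight-∈ μ sorted a∈) (weight-∈ μ sorted b∈)) (m+n∸m≡n a _))
  ... | no a∉  | no b∉  with complement-∈ a 1≤a 2a<m
  ...   | inj₁ a∈ = contradiction a∈ a∉
  ...   | inj₂ b∈ = contradiction b∈ b∉

  ≤-pairWeight : ∀ a → 1 ≤ a → a + a < m → a ≤ weight μ a + weight μ (m ∸ a)
  ≤-pairWeight a 1≤a 2a<m with complement-∈ a 1≤a 2a<m
  ... | inj₁ a∈ = ≤-trans (≤-reflexive (sym (weight-∈ μ sorted a∈))) (m≤m+n _ _)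
  ... | inj₂ b∈ = ≤-trans (m+n≤o⇒m≤o∸n a (<⇒≤ 2a<m))
                    (≤-trans (≤-reflexive (sym (weight-∈ μ sorted b∈))) (m≤n+m _ _))

  +<m : ∀ {k r} → m ≡ suc (k + k + r) → ∀ {a} → a ≤ k → a + a < m
  +<m {k} {r} m≡ a≤k = subst (_ <_) (sym m≡) (s≤s (≤-trans (+-mono-≤ a≤k a≤k) (m≤m+n (k + k) r)))

  sum-pairUp : ∀ k r → m ≡ suc (k + k + r) →
    sum μ ≡ triangle k + sumTo excess k + rangeSum (weight μ) (suc k) r + m
  sum-pairUp k r m≡ = begin
    sum μ
      ≡⟨ sum≡rangeSum-weight μ (suc m) (All.map s≤s μ≤m) ⟩
    rangeSum (weight μ) 0 (suc m)
      ≡⟨ rangeSum-snoc (weight μ) 0 m ⟩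
    rangeSum (weight μ) 0 m + weight μ m
      ≡⟨ cong₂ _+_ (rangeSum-pairUp (weight μ) k r m m≡) (weight-∈ μ sorted m∈μ) ⟩
    weight μ 0 + sumTo pairWeight k + rangeSum (weight μ) (suc k) r + m
      ≡⟨ cong (λ z → z + rangeSum (weight μ) (suc k) r + m)
           (cong₂ _+_ (weight-zero μ)
             (sumTo-∸-triangle pairWeight k (λ a 1≤a a≤k → ≤-pairWeight a 1≤a (+<m m≡ a≤k)))) ⟩
    triangle k + sumTo excess k + rangeSum (weight μ) (suc k) r + m ∎
    where
    open ≡-Reasoning
    pairWeight = λ a → weight μ a + weight μ (m ∸ a)

T-eq : ∀ p → T (11 + p) (9 + p) ≡ triangle (9 + p) + (12 + p)
T-eq p = begin
  (11 + p) * (12 + p) / 2 ∸ (9 + p)          ≡⟨ cong (λ z → z / 2 ∸ (9 + p)) (*-suc-triangle (11 + p)) ⟩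
  triangle (11 + p) * 2 / 2 ∸ (9 + p)        ≡⟨ cong (_∸ (9 + p)) (m*n/n≡m (triangle (11 + p)) 2) ⟩
  triangle (11 + p) ∸ (9 + p)                ≡⟨ cong (_∸ (9 + p)) (regroup (triangle (9 + p)) p) ⟩
  (9 + p) + (triangle (9 + p) + (12 + p)) ∸ (9 + p) ≡⟨ m+n∸m≡n (9 + p) _ ⟩
  triangle (9 + p) + (12 + p)                ∎
  where
  open ≡-Reasoning
  regroup : ∀ t p → t + (10 + p) + (11 + p) ≡ (9 + p) + (t + (12 + p))
  regroup = solve-∀

-- With n = 11 + p: the parts 1, …, n − 5, n − 2, n − 1 and 2n − 5.
top : ℕ → ℕ
top p = 17 + (p + p)

extremal : ℕ → List ℕ
extremal p = interval 1 (6 + p) ++ (9 + p) ∷ (10 + p) ∷ top p ∷ []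

module _ (p : ℕ) where

  ExtremalPart : ℕ → Set
  ExtremalPart x = (1 ≤ x × x ≤ 6 + p) ⊎ x ≡ 9 + p ⊎ x ≡ 10 + p ⊎ x ≡ top p

  ∈-extremal⁻ : ∀ {x} → x ∈ extremal p → ExtremalPart x
  ∈-extremal⁻ x∈ with ∈-++⁻ (interval 1 (6 + p)) x∈
  ... | inj₁ x∈low with ∈-interval⁻ 1 (6 + p) x∈low
  ...   | 1≤x , x≤ = inj₁ (1≤x , ≤-pred x≤)
  ∈-extremal⁻ x∈ | inj₂ (here x≡)                 = inj₂ (inj₁ x≡)
  ∈-extremal⁻ x∈ | inj₂ (there (here x≡))         = inj₂ (inj₂ (inj₁ x≡))
  ∈-extremal⁻ x∈ | inj₂ (there (there (here x≡))) = inj₂ (inj₂ (inj₂ x≡))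

  ∈-extremal-low : ∀ {x} → 1 ≤ x → x ≤ 6 + p → x ∈ extremal p
  ∈-extremal-low 1≤x x≤ = ∈-++⁺ˡ (∈-interval⁺ 1 (6 + p) 1≤x (s≤s x≤))

  ∈-extremal-9 : 9 + p ∈ extremal p
  ∈-extremal-9 = ∈-++⁺ʳ (interval 1 (6 + p)) (here refl)

  ∈-extremal-10 : 10 + p ∈ extremal p
  ∈-extremal-10 = ∈-++⁺ʳ (interval 1 (6 + p)) (there (here refl))

  ∈-extremal-top : top p ∈ extremal p
  ∈-extremal-top = ∈-++⁺ʳ (interval 1 (6 + p)) (there (there (here refl)))

  10+p<top : 10 + p < top p
  10+p<top = subst (11 + p ≤_) (split p) (m≤n+m _ (6 + p))
    where
    split : ∀ p → (6 + p) + (11 + p) ≡ 17 + (p + p)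
    split = solve-∀

  extremal-sorted : Linked _<_ (extremal p)
  extremal-sorted = interval-++-sorted 1 (6 + p) _ (≤-refl ∷ 10+p<top ∷ [-])
    (m≤n+m _ 2 ∷ m≤n+m _ 3 ∷ ≤-trans (m≤n+m _ 3) (<⇒≤ 10+p<top) ∷ [])

  extremal-bounds : All (λ x → 1 ≤ x × x ≤ top p) (extremal p)
  extremal-bounds = All.tabulate (bounds ∘ ∈-extremal⁻)
    where
    bounds : ∀ {x} → ExtremalPart x → 1 ≤ x × x ≤ top p
    bounds (inj₁ (1≤x , x≤))         = 1≤x , ≤-trans x≤ (≤-trans (m≤n+m _ 4) (<⇒≤ 10+p<top))
    bounds (inj₂ (inj₁ refl))        = s≤s z≤n , ≤-trans (m≤n+m _ 1) (<⇒≤ 10+p<top)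
    bounds (inj₂ (inj₂ (inj₁ refl))) = s≤s z≤n , <⇒≤ 10+p<top
    bounds (inj₂ (inj₂ (inj₂ refl))) = s≤s z≤n , ≤-refl

  extremal-largest : largest (extremal p) ≡ top p
  extremal-largest = largest-≡ (extremal p) (All.map proj₂ extremal-bounds) ∈-extremal-top

  extremal-sum : sum (extremal p) ≡ T (11 + p) (9 + p)
  extremal-sum = begin
    sum (extremal p)
      ≡⟨ sum-++ (interval 1 (6 + p)) upper ⟩
    sum (interval 1 (6 + p)) + sum upper
      ≡⟨ cong (_+ sum upper) (sum-interval 0 (6 + p)) ⟩
    (6 + p) * 0 + triangle (6 + p) + ((9 + p) + ((10 + p) + (top p + 0)))
      ≡⟨ regroup (triangle (6 + p)) p ⟩
    triangle (9 + p) + (12 + p)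
      ≡⟨ sym (T-eq p) ⟩
    T (11 + p) (9 + p) ∎
    where
    open ≡-Reasoning
    upper = (9 + p) ∷ (10 + p) ∷ top p ∷ []
    regroup : ∀ t p → (6 + p) * 0 + t + ((9 + p) + ((10 + p) + (17 + (p + p) + 0)))
                    ≡ t + (7 + p) + (8 + p) + (9 + p) + (12 + p)
    regroup = solve-∀

  extremal-length : 2 ≤ length (extremal p)
  extremal-length = subst (2 ≤_) (sym (length-++ (interval 1 (6 + p))))
    (≤-trans (s≤s (s≤s z≤n)) (m≤n+m 3 (length (interval 1 (6 + p)))))

  missing-extremal : ∀ {a} → IsMissing (extremal p) a → 7 + p ≤ a × (a ≤ 8 + p ⊎ 11 + p ≤ a)
  missing-extremal {a} (1≤a , _ , a∉) with a ≤? 6 + p | a ≤? 8 + p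
  ... | yes a≤6+p | _        = contradiction (∈-extremal-low 1≤a a≤6+p) a∉
  ... | no a≰6+p  | yes a≤8+p = ≰⇒> a≰6+p , inj₁ a≤8+p
  ... | no a≰6+p  | no a≰8+p  = ≰⇒> a≰6+p , inj₂ (≤∧≢⇒< (≤∧≢⇒< (≰⇒> a≰8+p) (≢-sym a≢9)) (≢-sym a≢10))
    where
    a≢9 : a ≢ 9 + p
    a≢9 refl = a∉ ∈-extremal-9
    a≢10 : a ≢ 10 + p
    a≢10 refl = a∉ ∈-extremal-10

  extremal-unrefinable : ¬ Refinable (extremal p)
  extremal-unrefinable (a , b , a-missing , b-missing , _ , a+b∈)
    with missing-extremal a-missing | missing-extremal b-missing
  ... | 7+p≤a , a-range | 7+p≤b , b-range = sum-case (∈-extremal⁻ a+b∈) a-range b-range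
    where
    a+b≰10+p : ¬ a + b ≤ 10 + p
    a+b≰10+p = ≰-by (3 + p) (arith p) ∘ ≤-trans (+-mono-≤ 7+p≤a 7+p≤b)
      where
      arith : ∀ p → (10 + p) + suc (3 + p) ≡ (7 + p) + (7 + p)
      arith = solve-∀
    sum-case : ExtremalPart (a + b) → a ≤ 8 + p ⊎ 11 + p ≤ a → b ≤ 8 + p ⊎ 11 + p ≤ b → ⊥
    sum-case (inj₁ (_ , ≤6+p))          _ _ = a+b≰10+p (≤-trans ≤6+p (m≤n+m _ 4))
    sum-case (inj₂ (inj₁ ≡9+p))         _ _ = a+b≰10+p (≤-trans (≤-reflexive ≡9+p) (n≤1+n _))
    sum-case (inj₂ (inj₂ (inj₁ ≡10+p))) _ _ = a+b≰10+p (≤-reflexive ≡10+p)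
    sum-case (inj₂ (inj₂ (inj₂ ≡top))) (inj₁ a≤8+p) (inj₁ b≤8+p) =
      ≰-by 0 (arith p) (subst (_≤ (8 + p) + (8 + p)) ≡top (+-mono-≤ a≤8+p b≤8+p))
      where
      arith : ∀ p → (8 + p) + (8 + p) + 1 ≡ 17 + (p + p)
      arith = solve-∀
    sum-case (inj₂ (inj₂ (inj₂ ≡top))) (inj₂ 11+p≤a) _ =
      ≰-by 0 (arith p) (subst ((11 + p) + (7 + p) ≤_) ≡top (+-mono-≤ 11+p≤a 7+p≤b))
      where
      arith : ∀ p → 17 + (p + p) + 1 ≡ (11 + p) + (7 + p)
      arith = solve-∀
    sum-case (inj₂ (inj₂ (inj₂ ≡top))) (inj₁ _) (inj₂ 11+p≤b) =
      ≰-by 0 (arith p) (subst ((7 + p) + (11 + p) ≤_) ≡top (+-mono-≤ 7+p≤a 11+p≤b))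
      where
      arith : ∀ p → 17 + (p + p) + 1 ≡ (7 + p) + (11 + p)
      arith = solve-∀

  extremal-∈𝕌 : Unrefinable (T (11 + p) (9 + p)) (extremal p)
  extremal-∈𝕌 = (extremal-sorted , All.map proj₁ extremal-bounds , extremal-sum , extremal-length) , extremal-unrefinable

module PartitionOfT
  (p : ℕ) (μ : List ℕ) (m : ℕ) (sorted : Linked _<_ μ) (positive : All (1 ≤_) μ)
  (m∈μ : m ∈ μ) (μ≤m : All (_≤ m) μ) (unrefinable : ¬ Refinable μ) (sum≡ : sum μ ≡ triangle (9 + p) + (12 + p)) where

  open LargestPart μ m sorted m∈μ μ≤m unrefinable

  half≤8+p : ∀ {k r} → m ≡ suc (k + k + r) → k ≤ 8 + p
  half≤8+p {k} {r} m≡ = ≮⇒≥ λ 8+p<k → ≰-by (6 + p) (arith (triangle (9 + p)) p) (begin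
    triangle (9 + p) + suc ((9 + p) + (9 + p))
      ≤⟨ +-mono-≤ (triangle-mono-≤ 8+p<k) (s≤s (≤-trans (+-mono-≤ 8+p<k 8+p<k) (m≤m+n (k + k) r))) ⟩
    triangle k + suc (k + k + r)
      ≡⟨ cong (triangle k +_) (sym m≡) ⟩
    triangle k + m
      ≤⟨ +-monoˡ-≤ m (≤-trans (m≤m+n (triangle k) _) (m≤m+n _ _)) ⟩
    triangle k + sumTo excess k + rangeSum (weight μ) (suc k) r + m
      ≡⟨ trans (sym (sum-pairUp k r m≡)) sum≡ ⟩
    triangle (9 + p) + (12 + p) ∎)
    where
    open ≤-Reasoning
    arith : ∀ t p → t + (12 + p) + suc (6 + p) ≡ t + suc ((9 + p) + (9 + p))
    arith = solve-∀

  excess-total : ∀ r → m ≡ suc ((8 + p) + (8 + p) + r) →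
    sumTo excess (8 + p) + rangeSum (weight μ) (9 + p) r + r ≡ 4
  excess-total r m≡ = +-cancelˡ-≡ (t + m) _ _ (begin
    t + m + (E + mid + r)               ≡⟨ regroup t m E mid r ⟩
    t + E + mid + m + r                 ≡⟨ cong (_+ r) (trans (sym (sum-pairUp (8 + p) r m≡)) sum≡) ⟩
    t + (9 + p) + (12 + p) + r          ≡⟨ arith t p r ⟩
    t + suc ((8 + p) + (8 + p) + r) + 4 ≡⟨ cong (λ z → t + z + 4) (sym m≡) ⟩
    t + m + 4                           ∎)
    where
    open ≡-Reasoning
    t = triangle (8 + p)
    E = sumTo excess (8 + p)
    mid = rangeSum (weight μ) (9 + p) r
    regroup : ∀ t m E mid r → t + m + (E + mid + r) ≡ t + E + mid + m + r
    regroup = solve-∀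
    arith : ∀ t p r → t + (9 + p) + (12 + p) + r ≡ t + suc ((8 + p) + (8 + p) + r) + 4
    arith = solve-∀

  m≢18+2p : ¬ m ≡ suc ((8 + p) + (8 + p) + 1)
  m≢18+2p m≡ = [ from-no (2 ∣? 3) , from-no (4 ≤? 3) ]′
    (subst EvenOr≥4 (+-cancelʳ-≡ 1 _ 3 (excess-total 1 m≡))
      (EvenOr≥4-+ (sumTo-closed EvenOr≥4 (inj₁ even-zero) EvenOr≥4-+ excess (8 + p) excess-even) middle))
    where
    EvenOr≥4 : ℕ → Set
    EvenOr≥4 x = 2 ∣ x ⊎ 4 ≤ x
    EvenOr≥4-+ : ∀ {x y} → EvenOr≥4 x → EvenOr≥4 y → EvenOr≥4 (x + y)
    EvenOr≥4-+ (inj₁ 2∣x) (inj₁ 2∣y) = inj₁ (∣m∣n⇒∣m+n 2∣x 2∣y)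
    EvenOr≥4-+ (inj₂ 4≤x) _          = inj₂ (≤-trans 4≤x (m≤m+n _ _))
    EvenOr≥4-+ (inj₁ _)   (inj₂ 4≤y) = inj₂ (≤-trans 4≤y (m≤n+m _ _))
    even-zero : 2 ∣ 0
    even-zero = divides 0 refl
    even-gap : ∀ a → a ≤ 8 + p → 2 ∣ m ∸ a ∸ a
    even-gap a a≤ = subst (2 ∣_) (sym (∸-+-assoc m a a))
      (∣m+n∣m⇒∣n (subst (2 ∣_) (sym (m+[n∸m]≡n (<⇒≤ (+<m m≡ a≤)))) (divides (9 + p) (trans m≡ (double+1 p))))
                 (divides a (double a)))
      where
      double+1 : ∀ p → suc ((8 + p) + (8 + p) + 1) ≡ (9 + p) * 2
      double+1 = solve-∀
      double : ∀ a → a + a ≡ a * 2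
      double = solve-∀
    excess-even : ∀ a → 1 ≤ a → a ≤ 8 + p → EvenOr≥4 (excess a)
    excess-even a 1≤a a≤ with pair a 1≤a (+<m m≡ a≤)
    ... | lower _ _ e = inj₁ (subst (2 ∣_) (sym e) even-zero)
    ... | upper _ _ e = inj₁ (subst (2 ∣_) (sym e) (even-gap a a≤))
    ... | both  _ _ e = inj₂ (subst (4 ≤_) (sym e) (m+n≤o⇒m≤o∸n 4 (≤-trans (+-monoʳ-≤ 4 a≤) 12+p≤m)))
      where
      12+p≤m : 12 + p ≤ m
      12+p≤m = subst (12 + p ≤_) (trans (split p) (sym m≡)) (m≤n+m _ (6 + p))
        where
        split : ∀ p → (6 + p) + (12 + p) ≡ suc ((8 + p) + (8 + p) + 1)
        split = solve-∀
    middle : EvenOr≥4 (weight μ (9 + p) + 0)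
    middle with 9 + p ∈? μ
    ... | yes ∈μ = inj₂ (subst (λ z → 4 ≤ z + 0) (sym (weight-∈ μ sorted ∈μ)) (m≤m+n 4 (5 + p + 0)))
    ... | no  ∉μ = inj₁ (subst (λ z → 2 ∣ z + 0) (sym (weight-∉ μ ∉μ)) even-zero)

  module LargestIsTop (m≡ : m ≡ suc ((8 + p) + (8 + p) + 0)) where

    m≡top : m ≡ top p
    m≡top = trans m≡ (arith p)
      where
      arith : ∀ p → suc ((8 + p) + (8 + p) + 0) ≡ 17 + (p + p)
      arith = solve-∀

    excess-sum≡4 : sumTo excess (8 + p) ≡ 4
    excess-sum≡4 = trans (sym (trans (+-identityʳ _) (+-identityʳ _))) (excess-total 0 m≡)

    5≤gap : ∀ {a} → a ≤ 6 + p → 5 ≤ m ∸ a ∸ a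
    5≤gap {a} a≤ = m+n≤o⇒m≤o∸n 5 (m+n≤o⇒m≤o∸n (5 + a)
      (≤-trans (+-mono-≤ (+-monoʳ-≤ 5 a≤) a≤) (≤-reflexive (trans (arith p) (sym m≡)))))
      where
      arith : ∀ p → 5 + (6 + p) + (6 + p) ≡ suc ((8 + p) + (8 + p) + 0)
      arith = solve-∀

    ZeroOr≥5 : ℕ → Set
    ZeroOr≥5 x = x ≡ 0 ⊎ 5 ≤ x

    ZeroOr≥5-+ : ∀ {x y} → ZeroOr≥5 x → ZeroOr≥5 y → ZeroOr≥5 (x + y)
    ZeroOr≥5-+ (inj₁ refl) (inj₁ refl) = inj₁ refl
    ZeroOr≥5-+ (inj₂ 5≤x)  _           = inj₂ (≤-trans 5≤x (m≤m+n _ _))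
    ZeroOr≥5-+ (inj₁ _)    (inj₂ 5≤y)  = inj₂ (≤-trans 5≤y (m≤n+m _ _))

    excess-zeroOr≥5 : ∀ a → 1 ≤ a → a ≤ 6 + p → ZeroOr≥5 (excess a)
    excess-zeroOr≥5 a 1≤a a≤ with pair a 1≤a (+<m m≡ (≤-trans a≤ (m≤n+m _ 2)))
    ... | lower _ _ e = inj₁ e
    ... | upper _ _ e = inj₂ (subst (5 ≤_) (sym e) (5≤gap a≤))
    ... | both  _ _ e = inj₂ (subst (5 ≤_) (sym e) (≤-trans (5≤gap a≤) (m∸n≤m (m ∸ a) a)))

    low-excess≡0 : sumTo excess (6 + p) ≡ 0
    low-excess≡0 with sumTo-closed ZeroOr≥5 (inj₁ refl) ZeroOr≥5-+ excess (6 + p) excess-zeroOr≥5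
    ... | inj₁ ≡0  = ≡0
    ... | inj₂ 5≤S = contradiction
      (subst (5 ≤_) excess-sum≡4 (≤-trans 5≤S (≤-trans (m≤m+n _ _) (m≤m+n _ _)))) (from-no (5 ≤? 4))

    low-excess-term≡0 : ∀ {a} → 1 ≤ a → a ≤ 6 + p → excess a ≡ 0
    low-excess-term≡0 {a} 1≤a a≤ = n≤0⇒n≡0 (subst (excess a ≤_) low-excess≡0 (term≤sumTo excess 1≤a a≤))

    lower-pair : ∀ a → 1 ≤ a → a ≤ 6 + p → a ∈ μ × m ∸ a ∉ μ
    lower-pair a 1≤a a≤ with pair a 1≤a (+<m m≡ (≤-trans a≤ (m≤n+m _ 2)))
    ... | lower a∈ b∉ _ = a∈ , b∉
    ... | upper _ _ e = contradiction (subst (5 ≤_) (trans (sym e) (low-excess-term≡0 1≤a a≤)) (5≤gap a≤)) λ ()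
    ... | both  _ _ e = contradiction
      (subst (5 ≤_) (trans (sym e) (low-excess-term≡0 1≤a a≤)) (≤-trans (5≤gap a≤) (m∸n≤m (m ∸ a) a))) λ ()

    excess7+excess8≡4 : excess (7 + p) + excess (8 + p) ≡ 4
    excess7+excess8≡4 =
      trans (cong (λ z → z + excess (7 + p) + excess (8 + p)) (sym low-excess≡0)) excess-sum≡4

    partner7 : m ∸ (7 + p) ≡ 10 + p
    partner7 = trans (cong (_∸ (7 + p)) (trans m≡ (arith p))) (m+n∸m≡n (7 + p) (10 + p))
      where
      arith : ∀ p → suc ((8 + p) + (8 + p) + 0) ≡ (7 + p) + (10 + p)
      arith = solve-∀

    partner8 : m ∸ (8 + p) ≡ 9 + p
    partner8 = trans (cong (_∸ (8 + p)) (trans m≡ (arith p))) (m+n∸m≡n (8 + p) (9 + p))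
      where
      arith : ∀ p → suc ((8 + p) + (8 + p) + 0) ≡ (8 + p) + (9 + p)
      arith = solve-∀

    gap7 : m ∸ (7 + p) ∸ (7 + p) ≡ 3
    gap7 = trans (cong (_∸ (7 + p)) partner7) (m+n∸n≡m 3 (7 + p))

    gap8 : m ∸ (8 + p) ∸ (8 + p) ≡ 1
    gap8 = trans (cong (_∸ (8 + p)) partner8) (m+n∸n≡m 1 (8 + p))

    excess≤gap : ∀ a → 1 ≤ a → a ≤ 8 + p → excess a ≤ 4 → excess a ≤ m ∸ a ∸ a
    excess≤gap a 1≤a a≤ ≤4 with pair a 1≤a (+<m m≡ a≤)
    ... | lower _ _ e = subst (_≤ m ∸ a ∸ a) (sym e) z≤n
    ... | upper _ _ e = ≤-reflexive e
    ... | both  _ _ e = contradiction (subst (_≤ 4) e ≤4) (<⇒≱ (m+n≤o⇒m≤o∸n 5 5+a≤m))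
      where
      5+a≤m : 5 + a ≤ m
      5+a≤m = ≤-trans (+-monoʳ-≤ 5 a≤) (subst (13 + p ≤_) (trans (arith p) (sym m≡)) (m≤n+m _ (4 + p)))
        where
        arith : ∀ p → (4 + p) + (13 + p) ≡ suc ((8 + p) + (8 + p) + 0)
        arith = solve-∀

    excess7≤3 : excess (7 + p) ≤ 3
    excess7≤3 = subst (excess (7 + p) ≤_) gap7
      (excess≤gap (7 + p) (s≤s z≤n) (n≤1+n _) (subst (excess (7 + p) ≤_) excess7+excess8≡4 (m≤m+n _ _)))

    excess8≤1 : excess (8 + p) ≤ 1
    excess8≤1 = subst (excess (8 + p) ≤_) gap8
      (excess≤gap (8 + p) (s≤s z≤n) ≤-refl (subst (excess (8 + p) ≤_) excess7+excess8≡4 (m≤n+m _ _)))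

    upper-pair7 : 7 + p ∉ μ × 10 + p ∈ μ
    upper-pair7 with pair (7 + p) (s≤s z≤n) (+<m m≡ {7 + p} (n≤1+n _))
    ... | upper a∉ b∈ _ = a∉ , subst (_∈ μ) partner7 b∈
    ... | lower _ _ e = contradiction
      (subst (_≤ 1) (trans (cong (_+ excess (8 + p)) (sym e)) excess7+excess8≡4) excess8≤1) (from-no (4 ≤? 1))
    ... | both  _ _ e = contradiction (subst (_≤ 3) (trans e partner7) excess7≤3) (<⇒≱ (m≤m+n 4 (6 + p)))

    upper-pair8 : 8 + p ∉ μ × 9 + p ∈ μ
    upper-pair8 with pair (8 + p) (s≤s z≤n) (+<m m≡ {8 + p} ≤-refl)
    ... | upper a∉ b∈ _ = a∉ , subst (_∈ μ) partner8 b∈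
    ... | lower _ _ e = contradiction
      (subst (_≤ 3) (trans (trans (sym (+-identityʳ _)) (cong (excess (7 + p) +_) (sym e))) excess7+excess8≡4) excess7≤3)
      (from-no (4 ≤? 3))
    ... | both  _ _ e = contradiction (subst (_≤ 1) (trans e partner8) excess8≤1) (<⇒≱ (m≤m+n 2 (7 + p)))

    μ⊆extremal : ∀ {x} → x ∈ μ → x ∈ extremal p
    μ⊆extremal {x} x∈ with x ≤? 6 + p
    ... | yes x≤ = ∈-extremal-low p (All.lookup positive x∈) x≤
    ... | no  x≰ with x ≟ 7 + p | x ≟ 8 + p | x ≟ 9 + p | x ≟ 10 + p | x ≟ m
    ...   | yes refl | _        | _        | _        | _        = contradiction x∈ (proj₁ upper-pair7)
    ...   | no _     | yes refl | _        | _        | _        = contradiction x∈ (proj₁ upper-pair8)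
    ...   | no _     | no _     | yes refl | _        | _        = ∈-extremal-9 p
    ...   | no _     | no _     | no _     | yes refl | _        = ∈-extremal-10 p
    ...   | no _     | no _     | no _     | no _     | yes refl = subst (_∈ extremal p) (sym m≡top) (∈-extremal-top p)
    ...   | no x≢7   | no x≢8   | no x≢9   | no x≢10  | no x≢m   =
      contradiction (subst (_∈ μ) (sym (m∸[m∸n]≡n x≤m)) x∈) (proj₂ (lower-pair (m ∸ x) 1≤m-x m-x≤6+p))
      where
      x≤m = All.lookup μ≤m x∈
      1≤m-x = m<n⇒0<n∸m (≤∧≢⇒< x≤m x≢m)
      11+p≤x : 11 + p ≤ x
      11+p≤x = ≤∧≢⇒< (≤∧≢⇒< (≤∧≢⇒< (≤∧≢⇒< (≰⇒> x≰) (x≢7 ∘ sym)) (x≢8 ∘ sym)) (x≢9 ∘ sym)) (x≢10 ∘ sym)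
      m-x≤6+p : m ∸ x ≤ 6 + p
      m-x≤6+p = ≤-trans (∸-monoʳ-≤ m 11+p≤x)
        (≤-reflexive (trans (cong (_∸ (11 + p)) (trans m≡ (arith p))) (m+n∸m≡n (11 + p) (6 + p))))
        where
        arith : ∀ p → suc ((8 + p) + (8 + p) + 0) ≡ (11 + p) + (6 + p)
        arith = solve-∀

    extremal⊆μ : ∀ {x} → x ∈ extremal p → x ∈ μ
    extremal⊆μ x∈ with ∈-extremal⁻ p x∈
    ... | inj₁ (1≤x , x≤)          = proj₁ (lower-pair _ 1≤x x≤)
    ... | inj₂ (inj₁ refl)          = proj₂ upper-pair8
    ... | inj₂ (inj₂ (inj₁ refl))   = proj₂ upper-pair7
    ... | inj₂ (inj₂ (inj₂ refl))   = subst (_∈ μ) m≡top m∈μ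

    μ≡extremal : μ ≡ extremal p
    μ≡extremal = strictlySorted-ext μ (extremal p) sorted (extremal-sorted p) μ⊆extremal extremal⊆μ

  largest-bound : m ≤ top p × (m ≡ top p → μ ≡ extremal p)
  largest-bound with positive-halve m (All.lookup positive m∈μ)
  ... | k , r , r≤1 , m≡ with m≤n⇒m<n∨m≡n (half≤8+p {k} {r} m≡) | r≤1
  ... | inj₂ refl | z≤n     = ≤-reflexive m≡top , λ _ → μ≡extremal
    where open LargestIsTop m≡
  ... | inj₂ refl | s≤s z≤n = contradiction m≡ m≢18+2p
  ... | inj₁ k<8+p | _      = <⇒≤ m<top , contradiction′
    where
    m<top : m < top p
    m<top = subst (_< top p) (sym m≡)
      (s≤s (s≤s (≤-trans (+-mono-≤ (+-mono-≤ (≤-pred k<8+p) (≤-pred k<8+p)) r≤1) (≤-reflexive (arith p)))))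
      where
      arith : ∀ p → (7 + p) + (7 + p) + 1 ≡ 15 + (p + p)
      arith = solve-∀
    contradiction′ : m ≡ top p → μ ≡ extremal p
    contradiction′ m≡top = contradiction m≡top (<⇒≢ m<top)

largest-𝕌 : ∀ p μ → Unrefinable (T (11 + p) (9 + p)) μ →
  largest μ ≤ top p × (largest μ ≡ top p → μ ≡ extremal p)
largest-𝕌 p []       ((_ , _ , _ , ()) , _)
largest-𝕌 p (x ∷ xs) ((sorted , positive , sum≡ , _) , unrefinable) =
  PartitionOfT.largest-bound p (x ∷ xs) (largest (x ∷ xs)) sorted positive
    (largest-∈ x xs) (≤-largest (x ∷ xs)) unrefinable (trans sum≡ (T-eq p))

corollary3p12 : ∀ (n : ℕ) → 11 ≤ n →
    ∃[ λs ] (MaxUnrefinable (T n (n ∸ 2)) λs ×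
      (∀ μ → MaxUnrefinable (T n (n ∸ 2)) μ → μ ≡ λs))
corollary3p12 n 11≤n with m≤n⇒∃[o]m+o≡n 11≤n
... | p , refl = extremal p , (extremal-∈𝕌 p , ≤-extremal) , unique
  where
  ≤-extremal : ∀ μ → Unrefinable (T (11 + p) (9 + p)) μ → largest μ ≤ largest (extremal p)
  ≤-extremal μ μ∈𝕌 = subst (largest μ ≤_) (sym (extremal-largest p)) (proj₁ (largest-𝕌 p μ μ∈𝕌))
  unique : ∀ μ → MaxUnrefinable (T (11 + p) (9 + p)) μ → μ ≡ extremal p
  unique μ (μ∈𝕌 , maximal) = proj₂ (largest-𝕌 p μ μ∈𝕌)
    (≤-antisym (proj₁ (largest-𝕌 p μ μ∈𝕌))
               (subst (_≤ largest μ) (extremal-largest p) (maximal (extremal p) (extremal-∈𝕌 p))))
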